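{- Let $n$ be a positive integer, let $S,T\subseteq\mathbb Z/n\mathbb Z$, and let $a,b,c$ be positive integers such that the sets \[(S-S)\cap\{1,\ldots,a-1\},\quad (T-T)\cap\{1,\ldots,a-1\},\quad (S-T)\cap\{ -(c-1),\ldots,b-1\}\] are all empty (where integers are viewed as residues mod $n$ and $X-Y=\{x-y:x\in X,y\in Y\}$). Then \[|S|+|T|\leq \max\left(\frac{n}{a},\frac{2n}{b+c}\right).\] Moreover: (a) if $a<\frac{b+c}2$ and equality holds, then $a\mid n$, one of $S,T$ is empty, and the other is a translate of $a\mathbb Z/n\mathbb Z$; (b) if $a>\frac{b+c}2$ and equality holds, then $(b+c)\mid n$, $S=T-c$, and both $S$ and $T$ are translates of $(b+c)\mathbb Z/n\mathbb Z$; (c) if $a=\frac{b+c}2$ and equality holds, then $a\mid n$, the sets $S$ and $T+a-c$ are disjoint, and $S\cup(T+a-c)$ is a translate of $a\mathbb Z/n\mathbb Z$. -}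

module Defs where

open import Data.Nat as ℕ using (ℕ; zero; suc; NonZero)
open import Data.Integer as ℤ using (ℤ; +_; -_; _-_)
open import Data.Integer.DivMod using (_%ℕ_; n%ℕd<d)
open import Data.Fin using (Fin; toℕ; fromℕ<)
open import Data.Fin.Subset using (Subset; _∈_)
open import Data.Vec using (tabulate; lookup)
open import Data.Rational as ℚ using (ℚ)
open import Data.Product using (∃)
open import Relation.Binary.PropositionalEquality using (_≡_)
open import Function.Bundles using (_⇔_)

-- ℤ/nℤ is modelled as Fin n (residues 0,…,n-1).

⟦_⟧ : {n : ℕ} .{{_ : NonZero n}} → ℤ → Fin n
⟦_⟧ {n} k = fromℕ< (n%ℕd<d k n)

rep : {n : ℕ} → Fin n → ℤ
rep x = + toℕ x

_⊖_ : {n : ℕ} .{{_ : NonZero n}} → Fin n → Fin n → Fin n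
x ⊖ y = ⟦ rep x - rep y ⟧

_⊕_ : {n : ℕ} .{{_ : NonZero n}} → Fin n → Fin n → Fin n
x ⊕ y = ⟦ rep x ℤ.+ rep y ⟧

_+ₛ_ : {n : ℕ} .{{_ : NonZero n}} → Subset n → Fin n → Subset n
X +ₛ t = tabulate (λ z → lookup X (z ⊖ t))

IsTranslateOfMultiples : {n : ℕ} .{{_ : NonZero n}} → ℕ → Subset n → Set
IsTranslateOfMultiples {n} m X =
  ∃ λ (t : Fin n) → (x : Fin n) → (x ∈ X) ⇔ (∃ λ (k : ℤ) → x ≡ t ⊕ ⟦ + m ℤ.* k ⟧)

bound : (n a b c : ℕ) .{{_ : NonZero a}} .{{_ : NonZero b}} → ℚ
bound n a (suc b) c = ((+ n) ℚ./ a) ℚ.⊔ ((+ (2 ℕ.* n)) ℚ./ suc (b ℕ.+ c))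

{-# OPTIONS --safe #-}
module Submission where

-- Pull S and T back to n-periodic subsets of ℤ. If 2a ≤ b + c, the points of S ∪ (T + a − c)
-- in ℤ/nℤ are pairwise at distance ≥ a (within S and within T by hypothesis, across by the
-- condition on S − T), so the windows {x, x + 1, …, x + a − 1} of its |S| + |T| points are
-- disjoint: (|S| + |T|)·a ≤ n. If 2a > b + c, the same argument applies to 2S ∪ (2T + b − c)
-- in ℤ/2nℤ with windows of length b + c: (|S| + |T|)·(b + c) ≤ 2n. When the bound is attained
-- the windows tile the cyclic group, so the point set is closed under adding the window length,
-- and a set with no gap shorter than m that is closed under +m is a coset of mℤ/Nℤ with m ∣ N.

open import Defs
open import Data.Nat as ℕ using (ℕ; zero; suc; NonZero; _<_; _≤_; _>_; _≮_; z≤n; s≤s)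
import Data.Nat.Properties as ℕP
import Data.Nat.DivMod as DivMod
open import Data.Nat.Divisibility using (_∣_; m%n≡0⇒n∣m)
import Data.Nat.Tactic.RingSolver as ℕ-Ring
open import Data.Integer as ℤ using (ℤ; +_; -[1+_]; -_; _+_; _*_; _-_; ∣_∣)
import Data.Integer.Properties as ℤP
open import Data.Integer.DivMod using (_%ℕ_; _/ℕ_; n%ℕd<d; a≡a%ℕn+[a/ℕn]*n)
open import Data.Integer.Tactic.RingSolver using (solve-∀)
open import Data.Fin as Fin using (Fin; toℕ; remQuot; splitAt)
import Data.Fin.Properties as FinP
open import Data.Fin.Subset using (Subset; _∈_; ⊥; _∩_; _∪_; inside; outside; Nonempty; Empty) renaming (∣_∣ to card)
import Data.Fin.Subset.Properties as SubsetP
open import Data.Vec using (_∷_; lookup; here; there)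
import Data.Vec.Properties as VecP
open import Data.Rational as ℚ using (ℚ)
import Data.Rational.Properties as ℚP
open import Data.Rational.Unnormalised as ℚᵘ using (mkℚᵘ)
import Data.Rational.Unnormalised.Properties as ℚᵘP
open import Data.Product using (∃; _×_; _,_; proj₁; proj₂)
open import Data.Sum using (_⊎_; inj₁; inj₂)
open import Data.Empty using (⊥-elim)
open import Function using (_∘_)
open import Function.Bundles using (_⇔_; mk⇔; Equivalence; Injection)
open import Function.Definitions using (Injective)
open import Function.Properties.Inverse using (↔⇒↣)
open import Relation.Nullary using (yes; no)
open import Relation.Binary.PropositionalEquality

-- Residues modulo N

remainder-unique : ∀ {N r s} (q t : ℤ) → r < N → s < N →
                   + r + q * + N ≡ + s + t * + N → r ≡ s
remainder-unique {N} {r} {s} q t r<N s<N eq =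
  ℤP.+-injective (ℤP.i-j≡0⇒i≡j (+ r) (+ s) (ℤP.∣i∣≡0⇒i≡0 ∣r-s∣≡0))
  where
  split : ∀ r s q t N → r - s ≡ (r + q * N) - (s + t * N) + (t - q) * N
  split = solve-∀
  r-s≡[t-q]*N : + r - + s ≡ (t - q) * + N
  r-s≡[t-q]*N = begin
    + r - + s                                             ≡⟨ split (+ r) (+ s) q t (+ N) ⟩
    (+ r + q * + N) - (+ s + t * + N) + (t - q) * + N     ≡⟨ cong (λ x → x - (+ s + t * + N) + (t - q) * + N) eq ⟩
    (+ s + t * + N) - (+ s + t * + N) + (t - q) * + N     ≡⟨ cong (_+ (t - q) * + N) (ℤP.+-inverseʳ (+ s + t * + N)) ⟩
    + 0 + (t - q) * + N                                   ≡⟨ ℤP.+-identityˡ ((t - q) * + N) ⟩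
    (t - q) * + N                                         ∎
    where open ≡-Reasoning
  ∣r-s∣<N : ∣ + r - + s ∣ < N
  ∣r-s∣<N = subst (_< N) (cong ∣_∣ (sym (ℤP.m-n≡m⊖n r s)))
              (ℕP.≤-<-trans (ℤP.∣m⊝n∣≤m⊔n r s) (ℕP.⊔-pres-<m r<N s<N))
  ∣r-s∣≡∣t-q∣*N : ∣ + r - + s ∣ ≡ ∣ t - q ∣ ℕ.* N
  ∣r-s∣≡∣t-q∣*N = trans (cong ∣_∣ r-s≡[t-q]*N) (ℤP.abs-* (t - q) (+ N))
  ∣r-s∣≡0 : ∣ + r - + s ∣ ≡ 0
  ∣r-s∣≡0 = trans ∣r-s∣≡∣t-q∣*N (cong (ℕ._* N) ∣t-q∣≡0)
    where
    ∣t-q∣≡0 : ∣ t - q ∣ ≡ 0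
    ∣t-q∣≡0 = ℕP.n<1⇒n≡0 (ℕP.*-cancelʳ-< N ∣ t - q ∣ 1
                (subst₂ _<_ ∣r-s∣≡∣t-q∣*N (sym (ℕP.*-identityˡ N)) ∣r-s∣<N))

module _ {N : ℕ} .{{_ : NonZero N}} where

  i≡rep⟦i⟧+[i/N]*N : ∀ i → i ≡ rep (⟦_⟧ {N} i) + (i /ℕ N) * + N
  i≡rep⟦i⟧+[i/N]*N i = trans (a≡a%ℕn+[a/ℕn]*n i N)
    (cong (λ r → + r + (i /ℕ N) * + N) (sym (FinP.toℕ-fromℕ< (n%ℕd<d i N))))

  ⟦i+k*N⟧≡⟦i⟧ : ∀ i k → ⟦ i + k * + N ⟧ ≡ ⟦_⟧ {N} i
  ⟦i+k*N⟧≡⟦i⟧ i k = FinP.toℕ-injective (remainder-unique ((i + k * + N) /ℕ N) (i /ℕ N + k)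
    (FinP.toℕ<n ⟦ i + k * + N ⟧) (FinP.toℕ<n ⟦ i ⟧) (begin
      rep ⟦ i + k * + N ⟧ + ((i + k * + N) /ℕ N) * + N   ≡⟨ i≡rep⟦i⟧+[i/N]*N (i + k * + N) ⟨
      i + k * + N                                        ≡⟨ cong (_+ k * + N) (i≡rep⟦i⟧+[i/N]*N i) ⟩
      rep ⟦ i ⟧ + (i /ℕ N) * + N + k * + N               ≡⟨ regroup (rep ⟦ i ⟧) (i /ℕ N) k (+ N) ⟩
      rep ⟦ i ⟧ + (i /ℕ N + k) * + N                     ∎))
    where
    open ≡-Reasoning
    regroup : ∀ r q k N → r + q * N + k * N ≡ r + (q + k) * N
    regroup = solve-∀

  ⟦i⟧≡⟦j⟧⇒i≡j+k*N : ∀ i j → ⟦_⟧ {N} i ≡ ⟦ j ⟧ → ∃ λ k → i ≡ j + k * + N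
  ⟦i⟧≡⟦j⟧⇒i≡j+k*N i j eq = p - q , (begin
    i                                   ≡⟨ i≡rep⟦i⟧+[i/N]*N i ⟩
    rep ⟦ i ⟧ + p * + N                 ≡⟨ cong (λ x → rep x + p * + N) eq ⟩
    rep ⟦ j ⟧ + p * + N                 ≡⟨ regroup (rep ⟦ j ⟧) p q (+ N) ⟩
    rep ⟦ j ⟧ + q * + N + (p - q) * + N ≡⟨ cong (_+ (p - q) * + N) (i≡rep⟦i⟧+[i/N]*N j) ⟨
    j + (p - q) * + N                   ∎)
    where
    open ≡-Reasoning
    p q : ℤ
    p = i /ℕ N
    q = j /ℕ N
    regroup : ∀ r p q N → r + p * N ≡ r + q * N + (p - q) * N
    regroup = solve-∀

  ⟦⟧-rep : ∀ (x : Fin N) → ⟦ rep x ⟧ ≡ x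
  ⟦⟧-rep x = FinP.toℕ-injective
    (trans (FinP.toℕ-fromℕ< (n%ℕd<d (rep x) N)) (DivMod.m<n⇒m%n≡m (FinP.toℕ<n x)))

  rep≡rep+k*N⇒≡ : ∀ {x y : Fin N} k → rep x ≡ rep y + k * + N → x ≡ y
  rep≡rep+k*N⇒≡ {x} {y} k eq = begin
    x                    ≡⟨ ⟦⟧-rep x ⟨
    ⟦ rep x ⟧            ≡⟨ cong ⟦_⟧ eq ⟩
    ⟦ rep y + k * + N ⟧  ≡⟨ ⟦i+k*N⟧≡⟦i⟧ (rep y) k ⟩
    ⟦ rep y ⟧            ≡⟨ ⟦⟧-rep y ⟩
    y                    ∎
    where open ≡-Reasoning

  ⟦⟧-homo-⊕ : ∀ i j → ⟦ i ⟧ ⊕ ⟦ j ⟧ ≡ ⟦_⟧ {N} (i + j)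
  ⟦⟧-homo-⊕ i j = sym (begin
    ⟦ i + j ⟧                             ≡⟨ cong ⟦_⟧ (cong₂ _+_ (i≡rep⟦i⟧+[i/N]*N i) (i≡rep⟦i⟧+[i/N]*N j)) ⟩
    ⟦ (x + p * + N) + (y + q * + N) ⟧     ≡⟨ cong ⟦_⟧ (regroup x y p q (+ N)) ⟩
    ⟦ (x + y) + (p + q) * + N ⟧           ≡⟨ ⟦i+k*N⟧≡⟦i⟧ (x + y) (p + q) ⟩
    ⟦ i ⟧ ⊕ ⟦ j ⟧                         ∎)
    where
    open ≡-Reasoning
    x y p q : ℤ
    x = rep ⟦ i ⟧
    y = rep ⟦ j ⟧
    p = i /ℕ N
    q = j /ℕ N
    regroup : ∀ x y p q N → (x + p * N) + (y + q * N) ≡ (x + y) + (p + q) * N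
    regroup = solve-∀

  ⟦⟧-homo-⊖ : ∀ i j → ⟦ i ⟧ ⊖ ⟦ j ⟧ ≡ ⟦_⟧ {N} (i - j)
  ⟦⟧-homo-⊖ i j = sym (begin
    ⟦ i - j ⟧                             ≡⟨ cong ⟦_⟧ (cong₂ _-_ (i≡rep⟦i⟧+[i/N]*N i) (i≡rep⟦i⟧+[i/N]*N j)) ⟩
    ⟦ (x + p * + N) - (y + q * + N) ⟧     ≡⟨ cong ⟦_⟧ (regroup x y p q (+ N)) ⟩
    ⟦ (x - y) + (p - q) * + N ⟧           ≡⟨ ⟦i+k*N⟧≡⟦i⟧ (x - y) (p - q) ⟩
    ⟦ i ⟧ ⊖ ⟦ j ⟧                         ∎)
    where
    open ≡-Reasoning
    x y p q : ℤ
    x = rep ⟦ i ⟧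
    y = rep ⟦ j ⟧
    p = i /ℕ N
    q = j /ℕ N
    regroup : ∀ x y p q N → (x + p * N) - (y + q * N) ≡ (x - y) + (p - q) * N
    regroup = solve-∀

  ⊕-⟦⟧ : ∀ (x : Fin N) j → x ⊕ ⟦ j ⟧ ≡ ⟦ rep x + j ⟧
  ⊕-⟦⟧ x j = trans (cong (_⊕ ⟦ j ⟧) (sym (⟦⟧-rep x))) (⟦⟧-homo-⊕ (rep x) j)

  ⊖-⟦⟧ : ∀ (x : Fin N) j → x ⊖ ⟦ j ⟧ ≡ ⟦ rep x - j ⟧
  ⊖-⟦⟧ x j = trans (cong (_⊖ ⟦ j ⟧) (sym (⟦⟧-rep x))) (⟦⟧-homo-⊖ (rep x) j)

-- Periodic subsets of ℤ

-- A subset of ℤ/Nℤ is handled through its preimage in ℤ, where the gap conditions become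
-- statements about exact differences. The definition is opaque so that unification can read
-- the integer off `lift X i`.
opaque
  lift : {N : ℕ} .{{_ : NonZero N}} → Subset N → ℤ → Set
  lift X i = ⟦ i ⟧ ∈ X

Periodic : ℕ → (ℤ → Set) → Set
Periodic N A = ∀ {i} k → A i → A (i + k * + N)

Separated : ℕ → (ℤ → Set) → Set
Separated m A = ∀ {i d} → A i → A (i + + d) → d < m → d ≡ 0

ClosedUnder+ : ℕ → (ℤ → Set) → Set
ClosedUnder+ m A = ∀ {i} → A i → A (i + + m)

Separated-resp-⇔ : ∀ {m} {A B : ℤ → Set} → (∀ z → A z ⇔ B z) → Separated m A → Separated m B
Separated-resp-⇔ A⇔B separated Bi Bi+d =
  separated (Equivalence.from (A⇔B _) Bi) (Equivalence.from (A⇔B _) Bi+d)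

ClosedUnder+-resp-⇔ : ∀ {m} {A B : ℤ → Set} → (∀ z → A z ⇔ B z) → ClosedUnder+ m A → ClosedUnder+ m B
ClosedUnder+-resp-⇔ A⇔B closed Bi = Equivalence.to (A⇔B _) (closed (Equivalence.from (A⇔B _) Bi))

module _ {N : ℕ} .{{_ : NonZero N}} where

  opaque
    unfolding lift

    ∈⇒lift : ∀ {X : Subset N} {i} → ⟦ i ⟧ ∈ X → lift X i
    ∈⇒lift i∈X = i∈X

    lift⇒∈ : ∀ {X : Subset N} {i} → lift X i → ⟦ i ⟧ ∈ X
    lift⇒∈ i∈X = i∈X

  lift-periodic : ∀ (X : Subset N) → Periodic N (lift X)
  lift-periodic X {i} k i∈X = ∈⇒lift (subst (_∈ X) (sym (⟦i+k*N⟧≡⟦i⟧ i k)) (lift⇒∈ i∈X))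

  rep∈lift : ∀ {X : Subset N} {x} → x ∈ X → lift X (rep x)
  rep∈lift {X} {x} x∈X = ∈⇒lift (subst (_∈ X) (sym (⟦⟧-rep x)) x∈X)

  ∈+ₛ⇔ : ∀ (X : Subset N) t x → x ∈ X +ₛ t ⇔ x ⊖ t ∈ X
  ∈+ₛ⇔ X t x = mk⇔
    (λ x∈X+t → VecP.lookup⇒[]= (x ⊖ t) X (trans (sym lookup-translate) (VecP.[]=⇒lookup x∈X+t)))
    (λ x-t∈X → VecP.lookup⇒[]= x (X +ₛ t) (trans lookup-translate (VecP.[]=⇒lookup x-t∈X)))
    where
    lookup-translate : lookup (X +ₛ t) x ≡ lookup X (x ⊖ t)
    lookup-translate = VecP.lookup∘tabulate (λ z → lookup X (z ⊖ t)) x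

module _ {m : ℕ} {A : ℤ → Set} (closed : ClosedUnder+ m A) where

  closed⇒+ℕ-multiple : ∀ {i} → A i → ∀ r → A (i + + m * + r)
  closed⇒+ℕ-multiple {i} Ai zero    = subst A (plus-zero i (+ m)) Ai
    where
    plus-zero : ∀ i m → i ≡ i + m * + 0
    plus-zero = solve-∀
  closed⇒+ℕ-multiple {i} Ai (suc r) = subst A (plus-step i (+ m) (+ r)) (closed (closed⇒+ℕ-multiple Ai r))
    where
    plus-step : ∀ i m r → i + m * r + m ≡ i + m * (+ 1 + r)
    plus-step = solve-∀

  closed⇒+multiple : ∀ {N} .{{_ : NonZero N}} → Periodic N A → ∀ {i} → A i → ∀ k → A (i + + m * k)
  closed⇒+multiple {N} periodic {i} Ai k = subst A i+m*r+m*q*N≡i+m*k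
    (periodic (+ m * (k /ℕ N)) (closed⇒+ℕ-multiple Ai (k %ℕ N)))
    where
    regroup : ∀ i m r q N → i + m * r + m * q * N ≡ i + m * (r + q * N)
    regroup = solve-∀
    i+m*r+m*q*N≡i+m*k : i + + m * + (k %ℕ N) + + m * (k /ℕ N) * + N ≡ i + + m * k
    i+m*r+m*q*N≡i+m*k = trans (regroup i (+ m) (+ (k %ℕ N)) (k /ℕ N) (+ N))
                              (cong (λ k → i + + m * k) (sym (a≡a%ℕn+[a/ℕn]*n k N)))

  module _ .{{_ : NonZero m}} (separated : Separated m A) where

    separated-closed⇒∣ : ∀ {i g} → A i → A (i + + g) → m ∣ g
    separated-closed⇒∣ {i} {g} Ai Ai+g =
      m%n≡0⇒n∣m g m (separated (closed⇒+ℕ-multiple Ai q) (subst A i+g≡i+m*q+r Ai+g) (DivMod.m%n<n g m))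
      where
      q r : ℕ
      q = g DivMod./ m
      r = g DivMod.% m
      regroup : ∀ i r q m → i + (r + q * m) ≡ i + m * q + r
      regroup = solve-∀
      i+g≡i+m*q+r : i + + g ≡ i + + m * + q + + r
      i+g≡i+m*q+r = begin
        i + + g                 ≡⟨ cong (λ g → i + + g) (DivMod.m≡m%n+[m/n]*n g m) ⟩
        i + + (r ℕ.+ q ℕ.* m)   ≡⟨ cong (_+_ i) (trans (ℤP.pos-+ r (q ℕ.* m)) (cong (_+_ (+ r)) (ℤP.pos-* q m))) ⟩
        i + (+ r + + q * + m)   ≡⟨ regroup i (+ r) (+ q) (+ m) ⟩
        i + + m * + q + + r     ∎
        where open ≡-Reasoning

    separated-closed⇒congruent : ∀ {N} .{{_ : NonZero N}} → Periodic N A →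
                                 ∀ {i j} → A i → A j → ∃ λ k → ⟦_⟧ {N} j ≡ ⟦ i + + m * k ⟧
    separated-closed⇒congruent {N} periodic {i} {j} Ai Aj = + t , (begin
      ⟦ j ⟧                   ≡⟨ cong ⟦_⟧ j≡i+g+q*N ⟩
      ⟦ i + + g + q * + N ⟧   ≡⟨ ⟦i+k*N⟧≡⟦i⟧ (i + + g) q ⟩
      ⟦ i + + g ⟧             ≡⟨ cong (λ g → ⟦ i + + g ⟧) (_∣_.equality m∣g) ⟩
      ⟦ i + + (t ℕ.* m) ⟧     ≡⟨ cong (λ z → ⟦ i + z ⟧) (trans (ℤP.pos-* t m) (ℤP.*-comm (+ t) (+ m))) ⟩
      ⟦ i + + m * + t ⟧       ∎)
      where
      open ≡-Reasoning
      g : ℕ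
      g = (j - i) %ℕ N
      q : ℤ
      q = (j - i) /ℕ N
      split : ∀ i j → j ≡ i + (j - i)
      split = solve-∀
      cancel : ∀ x q N → x + q * N + - q * N ≡ x
      cancel = solve-∀
      j≡i+g+q*N : j ≡ i + + g + q * + N
      j≡i+g+q*N = trans (split i j) (trans (cong (_+_ i) (a≡a%ℕn+[a/ℕn]*n (j - i) N))
                                           (sym (ℤP.+-assoc i (+ g) (q * + N))))
      m∣g : m ∣ g
      m∣g = separated-closed⇒∣ Ai
              (subst A (trans (cong (_+ - q * + N) j≡i+g+q*N) (cancel (i + + g) q (+ N))) (periodic (- q) Aj))
      t : ℕ
      t = _∣_.quotient m∣g

separated-closed⇒translate : ∀ {N m} .{{_ : NonZero N}} .{{_ : NonZero m}} (X : Subset N) →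
  Separated m (lift X) → ClosedUnder+ m (lift X) → Nonempty X → m ∣ N × IsTranslateOfMultiples m X
separated-closed⇒translate {N} {m} X separated closed (x₀ , x₀∈X) = m∣N , x₀ , λ x → mk⇔ (to x) (from x)
  where
  x₀∈lift : lift X (rep x₀)
  x₀∈lift = rep∈lift x₀∈X
  m∣N : m ∣ N
  m∣N = separated-closed⇒∣ {A = lift X} closed separated x₀∈lift
          (subst (lift X) (cong (_+_ (rep x₀)) (ℤP.*-identityˡ (+ N))) (lift-periodic X (+ 1) x₀∈lift))
  to : ∀ x → x ∈ X → ∃ λ k → x ≡ x₀ ⊕ ⟦ + m * k ⟧
  to x x∈X with separated-closed⇒congruent {A = lift X} closed separated {N} (lift-periodic X) x₀∈lift (rep∈lift x∈X)
  ... | k , eq = k , trans (sym (⟦⟧-rep x)) (trans eq (sym (⊕-⟦⟧ x₀ (+ m * k))))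
  from : ∀ x → (∃ λ k → x ≡ x₀ ⊕ ⟦ + m * k ⟧) → x ∈ X
  from x (k , refl) = subst (_∈ X) (sym (⊕-⟦⟧ x₀ (+ m * k)))
    (lift⇒∈ (closed⇒+multiple {A = lift X} closed (lift-periodic X) x₀∈lift k))

-- Counting separated points

injective⇒surjective : ∀ {m n} → m ≡ n → (f : Fin m → Fin n) → Injective _≡_ _≡_ f →
                       ∀ y → ∃ λ x → f x ≡ y
injective⇒surjective {suc m} refl f f-injective y with FinP.any? (λ x → f x FinP.≟ y)
... | yes hit  = hit
... | no  miss = ⊥-elim (ℕP.<-irrefl refl (FinP.injective⇒≤ punched-injective))
  where
  punched : Fin (suc m) → Fin m
  punched x = Fin.punchOut {i = y} {j = f x} (λ y≡fx → miss (x , sym y≡fx))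
  punched-injective : Injective _≡_ _≡_ punched
  punched-injective eq = f-injective (FinP.punchOut-injective {i = y} _ _ eq)

-- The window {p i, p i + 1, …, p i + m − 1} of each point p i of a separated family is disjoint
-- from the other windows, so the windows fit into ℤ/Nℤ; if they fill it, the residue of
-- z + m for z ∈ A lies in some window, and separation forces it to be the start of one.
module Counting {N m : ℕ} .{{_ : NonZero N}} {A : ℤ → Set}
  (periodic : Periodic N A) (separated : Separated m A)
  {k : ℕ} (p : Fin k → ℤ) (p∈A : ∀ i → A (p i))
  (p-injective : Injective _≡_ _≡_ (λ i → ⟦_⟧ {N} (p i))) where

  private
    windows-apart : ∀ {i j d e} → d ℕ.+ e < m →
                    ⟦_⟧ {N} (p i + + d) ≡ ⟦ p j + + (d ℕ.+ e) ⟧ → i ≡ j × e ≡ 0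
    windows-apart {i} {j} {d} {e} d+e<m eq with ⟦i⟧≡⟦j⟧⇒i≡j+k*N (p i + + d) (p j + + (d ℕ.+ e)) eq
    ... | l , pᵢ+d≡pⱼ+d+e+l*N = p-injective ⟦pᵢ⟧≡⟦pⱼ⟧ , e≡0
      where
      open ≡-Reasoning
      shift : ∀ x d → x ≡ x + d - d
      shift = solve-∀
      regroup : ∀ x d e y → x + (d + e) + y - d ≡ x + y + e
      regroup = solve-∀
      pᵢ≡pⱼ+l*N+e : p i ≡ p j + l * + N + + e
      pᵢ≡pⱼ+l*N+e = begin
        p i                                 ≡⟨ shift (p i) (+ d) ⟩
        p i + + d - + d                     ≡⟨ cong (_- + d) pᵢ+d≡pⱼ+d+e+l*N ⟩
        p j + + (d ℕ.+ e) + l * + N - + d   ≡⟨ cong (λ x → p j + x + l * + N - + d) (ℤP.pos-+ d e) ⟩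
        p j + (+ d + + e) + l * + N - + d   ≡⟨ regroup (p j) (+ d) (+ e) (l * + N) ⟩
        p j + l * + N + + e                 ∎
      e≡0 : e ≡ 0
      e≡0 = separated (periodic l (p∈A j)) (subst A pᵢ≡pⱼ+l*N+e (p∈A i)) (ℕP.≤-<-trans (ℕP.m≤n+m e d) d+e<m)
      ⟦pᵢ⟧≡⟦pⱼ⟧ : ⟦ p i ⟧ ≡ ⟦ p j ⟧
      ⟦pᵢ⟧≡⟦pⱼ⟧ = begin
        ⟦ p i ⟧                  ≡⟨ cong ⟦_⟧ pᵢ≡pⱼ+l*N+e ⟩
        ⟦ p j + l * + N + + e ⟧  ≡⟨ cong (λ e → ⟦ p j + l * + N + + e ⟧) e≡0 ⟩
        ⟦ p j + l * + N + + 0 ⟧  ≡⟨ cong ⟦_⟧ (ℤP.+-identityʳ (p j + l * + N)) ⟩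
        ⟦ p j + l * + N ⟧        ≡⟨ ⟦i+k*N⟧≡⟦i⟧ (p j) l ⟩
        ⟦ p j ⟧                  ∎

    window : Fin k × Fin m → Fin N
    window (i , d) = ⟦ p i + + toℕ d ⟧

    window-aligned : ∀ {i j} {d d′ : Fin m} → toℕ d ≤ toℕ d′ →
                     window (i , d) ≡ window (j , d′) → (i , d) ≡ (j , d′)
    window-aligned {i} {j} {d} {d′} d≤d′ eq with ℕP.m≤n⇒∃[o]m+o≡n d≤d′
    ... | e , d+e≡d′ with windows-apart (subst (_< m) (sym d+e≡d′) (FinP.toℕ<n d′))
                                        (subst (λ x → window (i , d) ≡ ⟦ p j + + x ⟧) (sym d+e≡d′) eq)
    ...   | i≡j , refl = cong₂ _,_ i≡j (FinP.toℕ-injective (trans (sym (ℕP.+-identityʳ (toℕ d))) d+e≡d′))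

    window-injective : Injective _≡_ _≡_ window
    window-injective {i , d} {j , d′} eq with ℕP.≤-total (toℕ d) (toℕ d′)
    ... | inj₁ d≤d′ = window-aligned d≤d′ eq
    ... | inj₂ d′≤d = sym (window-aligned d′≤d (sym eq))

    windows : Fin (k ℕ.* m) → Fin N
    windows = window ∘ remQuot m

    windows-injective : Injective _≡_ _≡_ windows
    windows-injective = Injection.injective (↔⇒↣ FinP.*↔×) ∘ window-injective

  k*m≤N : k ℕ.* m ≤ N
  k*m≤N = FinP.injective⇒≤ windows-injective

  k*m≡N⇒closed : k ℕ.* m ≡ N → ClosedUnder+ m A
  k*m≡N⇒closed k*m≡N {z} Az with injective⇒surjective k*m≡N windows windows-injective ⟦ z + + m ⟧
  ... | q , hit = in-window⇒closed (proj₁ (remQuot {k} m q)) (toℕ (proj₂ (remQuot {k} m q))) (FinP.toℕ<n _) hit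
    where
    advance : ∀ d e → d < m → d ℕ.+ e ≡ m → A (z + + e) → A (z + + m)
    advance zero    e _   refl Az+e = Az+e
    advance (suc d) e d<m d+e≡m Az+e with separated Az Az+e (subst (e <_) d+e≡m (ℕP.m<n+m e (s≤s z≤n)))
    ... | refl = ⊥-elim (ℕP.<-irrefl (trans (sym (ℕP.+-identityʳ (suc d))) d+e≡m) d<m)

    in-window⇒closed : ∀ i d → d < m → ⟦_⟧ {N} (p i + + d) ≡ ⟦ z + + m ⟧ → A (z + + m)
    in-window⇒closed i d d<m eq with ⟦i⟧≡⟦j⟧⇒i≡j+k*N (p i + + d) (z + + m) eq | ℕP.m≤n⇒∃[o]m+o≡n (ℕP.<⇒≤ d<m)
    ... | l , pᵢ+d≡z+m+l*N | e , d+e≡m = advance d e d<m d+e≡m (subst A pᵢ-l*N≡z+e (periodic (- l) (p∈A i)))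
      where
      open ≡-Reasoning
      shift : ∀ x d l N → x + - l * N ≡ x + d - d - l * N
      shift = solve-∀
      regroup : ∀ z d e l N → z + (d + e) + l * N - d - l * N ≡ z + e
      regroup = solve-∀
      pᵢ-l*N≡z+e : p i + - l * + N ≡ z + + e
      pᵢ-l*N≡z+e = begin
        p i + - l * + N                              ≡⟨ shift (p i) (+ d) l (+ N) ⟩
        p i + + d - + d - l * + N                    ≡⟨ cong (λ x → x - + d - l * + N) pᵢ+d≡z+m+l*N ⟩
        z + + m + l * + N - + d - l * + N            ≡⟨ cong (λ x → z + + x + l * + N - + d - l * + N) d+e≡m ⟨
        z + + (d ℕ.+ e) + l * + N - + d - l * + N    ≡⟨ cong (λ x → z + x + l * + N - + d - l * + N) (ℤP.pos-+ d e) ⟩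
        z + (+ d + + e) + l * + N - + d - l * + N    ≡⟨ regroup z (+ d) (+ e) l (+ N) ⟩
        z + + e                                      ∎

-- Scaled point sets

enum : ∀ {n} (X : Subset n) → Fin (card X) → Fin n
enum (inside  ∷ X) Fin.zero    = Fin.zero
enum (inside  ∷ X) (Fin.suc i) = Fin.suc (enum X i)
enum (outside ∷ X) i           = Fin.suc (enum X i)

enum-∈ : ∀ {n} (X : Subset n) i → enum X i ∈ X
enum-∈ (inside  ∷ X) Fin.zero    = here
enum-∈ (inside  ∷ X) (Fin.suc i) = there (enum-∈ X i)
enum-∈ (outside ∷ X) i           = there (enum-∈ X i)

enum-injective : ∀ {n} (X : Subset n) → Injective _≡_ _≡_ (enum X)
enum-injective (inside  ∷ X) {Fin.zero}  {Fin.zero}  _  = refl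
enum-injective (inside  ∷ X) {Fin.suc i} {Fin.suc j} eq = cong Fin.suc (enum-injective X (FinP.suc-injective eq))
enum-injective (outside ∷ X) eq                         = enum-injective X (FinP.suc-injective eq)

scale-nonneg : ∀ σ .{{_ : NonZero σ}} z {v} → + σ * z ≡ + v → ∃ λ u → z ≡ + u × v ≡ σ ℕ.* u
scale-nonneg σ       (+ u)    eq = u , refl , sym (ℤP.+-injective (trans (ℤP.pos-* σ u) eq))
scale-nonneg (suc σ) -[1+ k ] ()

scale-separated : ∀ σ .{{_ : NonZero σ}} {m A} → Separated m A →
                  ∀ {i j d} → A i → A j → + σ * i + + d ≡ + σ * j → d < σ ℕ.* m → i ≡ j × d ≡ 0
scale-separated σ {m} {A} separated {i} {j} {d} Ai Aj eq d<σm = conclude (scale-nonneg σ (j - i) σ[j-i]≡d)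
  where
  open ≡-Reasoning
  expand : ∀ s i j → s * (j - i) ≡ s * j - s * i
  expand = solve-∀
  cancel : ∀ x d → x + d - x ≡ d
  cancel = solve-∀
  split : ∀ i j → j ≡ i + (j - i)
  split = solve-∀
  σ[j-i]≡d : + σ * (j - i) ≡ + d
  σ[j-i]≡d = begin
    + σ * (j - i)              ≡⟨ expand (+ σ) i j ⟩
    + σ * j - + σ * i          ≡⟨ cong (_- + σ * i) eq ⟨
    + σ * i + + d - + σ * i    ≡⟨ cancel (+ σ * i) (+ d) ⟩
    + d                        ∎
  conclude : (∃ λ u → j - i ≡ + u × d ≡ σ ℕ.* u) → i ≡ j × d ≡ 0
  conclude (u , j-i≡u , d≡σu) = sym j≡i , trans d≡σu (trans (cong (σ ℕ.*_) u≡0) (ℕP.*-zeroʳ σ))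
    where
    j≡i+u : j ≡ i + + u
    j≡i+u = trans (split i j) (cong (_+_ i) j-i≡u)
    u≡0 : u ≡ 0
    u≡0 = separated Ai (subst A j≡i+u Aj) (ℕP.*-cancelˡ-< σ u m (subst (_< σ ℕ.* m) d≡σu d<σm))
    j≡i : j ≡ i
    j≡i = trans j≡i+u (trans (cong (λ u → i + + u) u≡0) (ℤP.+-identityʳ i))

-- No i ∈ A and j ∈ B with i − j ∈ (−c, b), written with u = i − j + c ∈ (0, b + c).
Apart : ℕ → ℕ → (ℤ → Set) → (ℤ → Set) → Set
Apart b c A B = ∀ {i j u} → A i → B j → i - j + + c ≡ + u → 0 < u → u ≮ b ℕ.+ c

scale-apart : ∀ σ .{{_ : NonZero σ}} {b c A B} → Apart b c A B →
              ∀ {i j v} → A i → B j → + σ * (i - j + + c) ≡ + v → 0 < v → v ≮ σ ℕ.* (b ℕ.+ c)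
scale-apart σ {b} {c} apart {i} {j} {v} Ai Bj eq 0<v v<σ[b+c] with scale-nonneg σ (i - j + + c) eq
... | u , i-j+c≡u , v≡σu = apart Ai Bj i-j+c≡u (ℕP.n≢0⇒n>0 u≢0)
                            (ℕP.*-cancelˡ-< σ u (b ℕ.+ c) (subst (_< σ ℕ.* (b ℕ.+ c)) v≡σu v<σ[b+c]))
  where
  u≢0 : u ≢ 0
  u≢0 u≡0 = ℕP.n>0⇒n≢0 0<v (trans v≡σu (trans (cong (σ ℕ.*_) u≡0) (ℕP.*-zeroʳ σ)))

-- The points σ·S ∪ (σ·T + μ) of ℤ/σnℤ, with windows of length m. The case 2a ≤ b + c uses
-- σ = 1, μ = a − c, M = m = a, and the case 2a > b + c uses σ = 2, μ = b − c, M = m = b + c;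
-- M = σc + μ is the offset through which the S−T gap condition separates the two kinds of points.
module TwoSets {n : ℕ} .{{_ : NonZero n}} (S T : Subset n) {a b c : ℕ}
  (S-separated : Separated a (lift S)) (T-separated : Separated a (lift T))
  (S-T-apart : Apart b c (lift S) (lift T))
  (σ : ℕ) .{{_ : NonZero σ}} (μ : ℤ) {m M : ℕ} .{{_ : NonZero m}}
  (σc+μ≡M : + σ * + c + μ ≡ + M) (m≤M : m ≤ M) (M+m≤σ[b+c] : M ℕ.+ m ≤ σ ℕ.* (b ℕ.+ c))
  (m≤σa : m ≤ σ ℕ.* a) where

  private instance
    σn≢0 : NonZero (σ ℕ.* n)
    σn≢0 = ℕP.m*n≢0 σ n

  Image : ℤ → Set
  Image z = (∃ λ i → lift S i × z ≡ + σ * i) ⊎ (∃ λ j → lift T j × z ≡ + σ * j + μ)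

  private
    0<m : 0 < m
    0<m = ℕ.>-nonZero⁻¹ m

    0<M : 0 < M
    0<M = ℕP.<-≤-trans 0<m m≤M

    M<σ[b+c] : M < σ ℕ.* (b ℕ.+ c)
    M<σ[b+c] = ℕP.<-≤-trans (ℕP.m<m+n M 0<m) M+m≤σ[b+c]

    σ-shift : ∀ i k → + σ * i + k * + (σ ℕ.* n) ≡ + σ * (i + k * + n)
    σ-shift i k = trans (cong (λ x → + σ * i + k * x) (ℤP.pos-* σ n)) (distrib (+ σ) i k (+ n))
      where
      distrib : ∀ s i k n → s * i + k * (s * n) ≡ s * (i + k * n)
      distrib = solve-∀

    σ-shift-μ : ∀ j k → + σ * j + μ + k * + (σ ℕ.* n) ≡ + σ * (j + k * + n) + μ
    σ-shift-μ j k = trans (swap (+ σ * j) μ (k * + (σ ℕ.* n))) (cong (_+ μ) (σ-shift j k))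
      where
      swap : ∀ x μ y → x + μ + y ≡ x + y + μ
      swap = solve-∀

    cancel-μ : ∀ {x y} → x + μ ≡ y + μ → x ≡ y
    cancel-μ {x} {y} eq = trans (uncancel x μ) (trans (cong (_- μ) eq) (sym (uncancel y μ)))
      where
      uncancel : ∀ x μ → x ≡ x + μ - μ
      uncancel = solve-∀

  shifted-T-separated : ∀ {j j′ d} → lift T j → lift T j′ → + σ * j + μ + + d ≡ + σ * j′ + μ →
                        d < σ ℕ.* a → j ≡ j′ × d ≡ 0
  shifted-T-separated {j} {j′} {d} Tj Tj′ eq =
    scale-separated σ T-separated Tj Tj′ (cancel-μ (trans (swap (+ σ * j) (+ d) μ) eq))
    where
    swap : ∀ x d μ → x + d + μ ≡ x + μ + d
    swap = solve-∀

  S-below-T : ∀ {i j d} → lift S i → lift T j → + σ * i + + d ≡ + σ * j + μ → d ≮ M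
  S-below-T {i} {j} {d} Si Tj eq d<M with ℕP.m≤n⇒∃[o]m+o≡n (ℕP.<⇒≤ d<M)
  ... | e , d+e≡M = scale-apart σ {b} {c} {lift S} {lift T} S-T-apart {i} {j} Si Tj σ[i-j+c]≡e
                      (ℕP.n≢0⇒n>0 e≢0) (ℕP.≤-<-trans (subst (e ≤_) d+e≡M (ℕP.m≤n+m e d)) M<σ[b+c])
    where
    open ≡-Reasoning
    e≢0 : e ≢ 0
    e≢0 e≡0 = ℕP.<-irrefl (trans (sym (ℕP.+-identityʳ d)) (trans (cong (d ℕ.+_) (sym e≡0)) d+e≡M)) d<M
    expand : ∀ s i j c d μ → s * (i - j + c) ≡ (s * i + d) - (s * j + μ) + (s * c + μ) - d
    expand = solve-∀
    cancel : ∀ x d e → x - x + (d + e) - d ≡ e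
    cancel = solve-∀
    σ[i-j+c]≡e : + σ * (i - j + + c) ≡ + e
    σ[i-j+c]≡e = begin
      + σ * (i - j + + c)                                ≡⟨ expand (+ σ) i j (+ c) (+ d) μ ⟩
      (+ σ * i + + d) - (+ σ * j + μ) + (+ σ * + c + μ) - + d
                                                         ≡⟨ cong₂ (λ x y → x - (+ σ * j + μ) + y - + d) eq σc+μ≡M ⟩
      (+ σ * j + μ) - (+ σ * j + μ) + + M - + d          ≡⟨ cong (λ x → (+ σ * j + μ) - (+ σ * j + μ) + + x - + d) d+e≡M ⟨
      (+ σ * j + μ) - (+ σ * j + μ) + + (d ℕ.+ e) - + d  ≡⟨ cong (λ x → (+ σ * j + μ) - (+ σ * j + μ) + x - + d) (ℤP.pos-+ d e) ⟩
      (+ σ * j + μ) - (+ σ * j + μ) + (+ d + + e) - + d  ≡⟨ cancel (+ σ * j + μ) (+ d) (+ e) ⟩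
      + e                                                ∎

  T-below-S : ∀ {j i d} → lift T j → lift S i → + σ * j + μ + + d ≡ + σ * i → M ℕ.+ d ≮ σ ℕ.* (b ℕ.+ c)
  T-below-S {j} {i} {d} Tj Si eq = scale-apart σ {b} {c} {lift S} {lift T} S-T-apart {i} {j} Si Tj
                                     σ[i-j+c]≡M+d (ℕP.<-≤-trans 0<M (ℕP.m≤m+n M d))
    where
    open ≡-Reasoning
    expand : ∀ s i j c μ → s * (i - j + c) ≡ s * i - (s * j + μ) + (s * c + μ)
    expand = solve-∀
    cancel : ∀ x d M → x + d - x + M ≡ M + d
    cancel = solve-∀
    σ[i-j+c]≡M+d : + σ * (i - j + + c) ≡ + (M ℕ.+ d)
    σ[i-j+c]≡M+d = begin
      + σ * (i - j + + c)                            ≡⟨ expand (+ σ) i j (+ c) μ ⟩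
      + σ * i - (+ σ * j + μ) + (+ σ * + c + μ)      ≡⟨ cong₂ (λ x y → x - (+ σ * j + μ) + y) (sym eq) σc+μ≡M ⟩
      (+ σ * j + μ + + d) - (+ σ * j + μ) + + M      ≡⟨ cancel (+ σ * j + μ) (+ d) (+ M) ⟩
      + M + + d                                      ≡⟨ ℤP.pos-+ M d ⟨
      + (M ℕ.+ d)                                    ∎

  image-periodic : Periodic (σ ℕ.* n) Image
  image-periodic k (inj₁ (i , Si , refl)) = inj₁ (i + k * + n , lift-periodic S k Si , σ-shift i k)
  image-periodic k (inj₂ (j , Tj , refl)) = inj₂ (j + k * + n , lift-periodic T k Tj , σ-shift-μ j k)

  image-separated : Separated m Image
  image-separated (inj₁ (i , Si , refl)) (inj₁ (i′ , Si′ , eq)) d<m =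
    proj₂ (scale-separated σ S-separated Si Si′ eq (ℕP.<-≤-trans d<m m≤σa))
  image-separated (inj₂ (j , Tj , refl)) (inj₂ (j′ , Tj′ , eq)) d<m =
    proj₂ (shifted-T-separated Tj Tj′ eq (ℕP.<-≤-trans d<m m≤σa))
  image-separated (inj₁ (i , Si , refl)) (inj₂ (j , Tj , eq)) d<m =
    ⊥-elim (S-below-T Si Tj eq (ℕP.<-≤-trans d<m m≤M))
  image-separated (inj₂ (j , Tj , refl)) (inj₁ (i , Si , eq)) d<m =
    ⊥-elim (T-below-S Tj Si eq (ℕP.<-≤-trans (ℕP.+-monoʳ-< M d<m) M+m≤σ[b+c]))

  private
    point : Fin (card S) ⊎ Fin (card T) → ℤ
    point (inj₁ u) = + σ * rep (enum S u)
    point (inj₂ v) = + σ * rep (enum T v) + μ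

    point∈image : ∀ w → Image (point w)
    point∈image (inj₁ u) = inj₁ (rep (enum S u) , rep∈lift (enum-∈ S u) , refl)
    point∈image (inj₂ v) = inj₂ (rep (enum T v) , rep∈lift (enum-∈ T v) , refl)

    points-apart : ∀ w w′ l → point w ≡ point w′ + l * + (σ ℕ.* n) → w ≡ w′
    points-apart (inj₁ u) (inj₁ u′) l eq = cong inj₁ (enum-injective S (rep≡rep+k*N⇒≡ l
      (ℤP.*-cancelˡ-≡ (+ σ) _ _ (trans eq (σ-shift (rep (enum S u′)) l)))))
    points-apart (inj₂ v) (inj₂ v′) l eq = cong inj₂ (enum-injective T (rep≡rep+k*N⇒≡ l
      (ℤP.*-cancelˡ-≡ (+ σ) _ _ (cancel-μ (trans eq (σ-shift-μ (rep (enum T v′)) l))))))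
    points-apart (inj₁ u) (inj₂ v) l eq = ⊥-elim (S-below-T {d = 0}
      (rep∈lift (enum-∈ S u)) (lift-periodic T l (rep∈lift (enum-∈ T v)))
      (trans (ℤP.+-identityʳ (point (inj₁ u))) (trans eq (σ-shift-μ (rep (enum T v)) l))) 0<M)
    points-apart (inj₂ v) (inj₁ u) l eq = ⊥-elim (T-below-S {d = 0}
      (rep∈lift (enum-∈ T v)) (lift-periodic S l (rep∈lift (enum-∈ S u)))
      (trans (ℤP.+-identityʳ (point (inj₂ v))) (trans eq (σ-shift (rep (enum S u)) l)))
      (subst (_< σ ℕ.* (b ℕ.+ c)) (sym (ℕP.+-identityʳ M)) M<σ[b+c]))

    family : Fin (card S ℕ.+ card T) → ℤ
    family = point ∘ splitAt (card S)

    family-injective : Injective _≡_ _≡_ (λ i → ⟦_⟧ {σ ℕ.* n} (family i))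
    family-injective {i} {j} eq with ⟦i⟧≡⟦j⟧⇒i≡j+k*N (family i) (family j) eq
    ... | l , family-i≡family-j+l*σn = Injection.injective (↔⇒↣ FinP.+↔⊎)
      (points-apart (splitAt (card S) i) (splitAt (card S) j) l family-i≡family-j+l*σn)

  open Counting {σ ℕ.* n} {m} {Image} image-periodic image-separated
                family (point∈image ∘ splitAt (card S)) family-injective public
    renaming (k*m≤N to [∣S∣+∣T∣]*m≤σn; k*m≡N⇒closed to [∣S∣+∣T∣]*m≡σn⇒image-closed)

-- The rational bound

x*e≤y*d⇒x/d≤y/e : ∀ x y d e → x ℕ.* suc e ≤ y ℕ.* suc d → + x ℚ./ suc d ℚ.≤ + y ℚ./ suc e
x*e≤y*d⇒x/d≤y/e x y d e le = ℚP.toℚᵘ-cancel-≤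
  (ℚᵘP.≤-respˡ-≃ (ℚᵘP.≃-sym (ℚP.toℚᵘ-fromℚᵘ (mkℚᵘ (+ x) d)))
    (ℚᵘP.≤-respʳ-≃ (ℚᵘP.≃-sym (ℚP.toℚᵘ-fromℚᵘ (mkℚᵘ (+ y) e)))
      (ℚᵘ.*≤* (subst₂ ℤ._≤_ (ℤP.pos-* x (suc e)) (ℤP.pos-* y (suc d)) (ℤ.+≤+ le)))))

private
  2*a*n≡2*n*a : ∀ a n → 2 ℕ.* a ℕ.* n ≡ 2 ℕ.* n ℕ.* a
  2*a*n≡2*n*a = ℕ-Ring.solve-∀

k*a≤n⇒k≤bound : ∀ n a b c k .{{_ : NonZero a}} .{{_ : NonZero b}} →
                k ℕ.* a ≤ n → + k ℚ./ 1 ℚ.≤ bound n a b c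
k*a≤n⇒k≤bound n (suc a′) (suc b′) c k k*a≤n = ℚP.≤-trans
  (x*e≤y*d⇒x/d≤y/e k n 0 a′ (subst (k ℕ.* suc a′ ≤_) (sym (ℕP.*-identityʳ n)) k*a≤n))
  (ℚP.p≤p⊔q (+ n ℚ./ suc a′) (+ (2 ℕ.* n) ℚ./ suc (b′ ℕ.+ c)))

k*[b+c]≤2n⇒k≤bound : ∀ n a b c k .{{_ : NonZero a}} .{{_ : NonZero b}} →
                     k ℕ.* (b ℕ.+ c) ≤ 2 ℕ.* n → + k ℚ./ 1 ℚ.≤ bound n a b c
k*[b+c]≤2n⇒k≤bound n (suc a′) (suc b′) c k k*[b+c]≤2n = ℚP.≤-trans
  (x*e≤y*d⇒x/d≤y/e k (2 ℕ.* n) 0 (b′ ℕ.+ c)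
    (subst (k ℕ.* suc (b′ ℕ.+ c) ≤_) (sym (ℕP.*-identityʳ (2 ℕ.* n))) k*[b+c]≤2n))
  (ℚP.p≤q⊔p (+ n ℚ./ suc a′) (+ (2 ℕ.* n) ℚ./ suc (b′ ℕ.+ c)))

k≡bound⇒k*a≡n : ∀ n a b c k .{{_ : NonZero a}} .{{_ : NonZero b}} →
                2 ℕ.* a ≤ b ℕ.+ c → + k ℚ./ 1 ≡ bound n a b c → k ℕ.* a ≡ n
k≡bound⇒k*a≡n n (suc a′) (suc b′) c k 2a≤b+c k≡bound =
  trans (ℚP.normalize-injective-≃ k n 1 (suc a′) (trans k≡bound bound≡n/a)) (ℕP.*-identityʳ n)
  where
  bound≡n/a : bound n (suc a′) (suc b′) c ≡ + n ℚ./ suc a′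
  bound≡n/a = ℚP.p≥q⇒p⊔q≡p (x*e≤y*d⇒x/d≤y/e (2 ℕ.* n) n (b′ ℕ.+ c) a′
    (subst₂ _≤_ (2*a*n≡2*n*a (suc a′) n) (ℕP.*-comm (suc (b′ ℕ.+ c)) n) (ℕP.*-monoˡ-≤ n 2a≤b+c)))

k≡bound⇒k*[b+c]≡2n : ∀ n a b c k .{{_ : NonZero a}} .{{_ : NonZero b}} →
                     b ℕ.+ c < 2 ℕ.* a → + k ℚ./ 1 ≡ bound n a b c → k ℕ.* (b ℕ.+ c) ≡ 2 ℕ.* n
k≡bound⇒k*[b+c]≡2n n (suc a′) (suc b′) c k b+c<2a k≡bound =
  trans (ℚP.normalize-injective-≃ k (2 ℕ.* n) 1 (suc (b′ ℕ.+ c)) (trans k≡bound bound≡2n/[b+c]))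
        (ℕP.*-identityʳ (2 ℕ.* n))
  where
  bound≡2n/[b+c] : bound n (suc a′) (suc b′) c ≡ + (2 ℕ.* n) ℚ./ suc (b′ ℕ.+ c)
  bound≡2n/[b+c] = ℚP.p≤q⇒p⊔q≡q (x*e≤y*d⇒x/d≤y/e n (2 ℕ.* n) a′ (b′ ℕ.+ c)
    (subst₂ _≤_ (ℕP.*-comm (suc (b′ ℕ.+ c)) n) (2*a*n≡2*n*a (suc a′) n) (ℕP.*-monoˡ-≤ n (ℕP.<⇒≤ b+c<2a))))

-- The three cases

lift-separated : ∀ {N m} .{{_ : NonZero N}} {X : Subset N} →
                 (∀ x y → x ∈ X → y ∈ X → (d : ℕ) → 1 ≤ d → d < m → x ⊖ y ≢ ⟦ + d ⟧) →
                 Separated m (lift X)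
lift-separated gaps {i} {zero}  _  _    _   = refl
lift-separated gaps {i} {suc d} Xi Xi+d d<m = ⊥-elim
  (gaps ⟦ i + + suc d ⟧ ⟦ i ⟧ (lift⇒∈ Xi+d) (lift⇒∈ Xi) (suc d) (s≤s z≤n) d<m
    (trans (⟦⟧-homo-⊖ (i + + suc d) i) (cong ⟦_⟧ (cancel i (+ suc d)))))
  where
  cancel : ∀ i d → i + d - i ≡ d
  cancel = solve-∀

lift-apart : ∀ {N b c} .{{_ : NonZero N}} {S T : Subset N} →
             (∀ x y → x ∈ S → y ∈ T → (d : ℤ) → - (+ c) ℤ.< d → d ℤ.< + b → x ⊖ y ≢ ⟦ d ⟧) →
             Apart b c (lift S) (lift T)
lift-apart {b = b} {c} gaps {i} {j} {u} Si Tj i-j+c≡u 0<u u<b+c =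
  gaps ⟦ i ⟧ ⟦ j ⟧ (lift⇒∈ Si) (lift⇒∈ Tj) (+ u - + c) -c<u-c u-c<b
    (trans (⟦⟧-homo-⊖ i j) (cong ⟦_⟧ (trans (uncancel (i - j) (+ c)) (cong (_- + c) i-j+c≡u))))
  where
  uncancel : ∀ x c → x ≡ x + c - c
  uncancel = solve-∀
  cancel : ∀ b c → b + c - c ≡ b
  cancel = solve-∀
  -c<u-c : - (+ c) ℤ.< + u - + c
  -c<u-c = subst (ℤ._< + u - + c) (ℤP.+-identityˡ (- (+ c))) (ℤP.+-monoˡ-< (- (+ c)) (ℤ.+<+ 0<u))
  u-c<b : + u - + c ℤ.< + b
  u-c<b = subst (+ u - + c ℤ.<_) (trans (cong (_- + c) (ℤP.pos-+ b c)) (cancel (+ b) (+ c)))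
                (ℤP.+-monoˡ-< (- (+ c)) (ℤ.+<+ u<b+c))

0<∣S∣+∣T∣⇒S≠∅⊎T≠∅ : ∀ {n} (S T : Subset n) → 0 < card S ℕ.+ card T → Nonempty S ⊎ Nonempty T
0<∣S∣+∣T∣⇒S≠∅⊎T≠∅ {n} S T 0<∣S∣+∣T∣ with SubsetP.nonempty? S | SubsetP.nonempty? T
... | yes S≠∅ | _       = inj₁ S≠∅
... | no  _   | yes T≠∅ = inj₂ T≠∅
... | no  S=∅ | no  T=∅ = ⊥-elim (ℕP.<-irrefl (sym (cong₂ ℕ._+_ (card≡0 S=∅) (card≡0 T=∅))) 0<∣S∣+∣T∣)
  where
  card≡0 : ∀ {X : Subset n} → Empty X → card X ≡ 0
  card≡0 X=∅ = trans (cong card (SubsetP.Empty-unique X=∅)) (SubsetP.∣⊥∣≡0 n)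

k*m≡N⇒0<k : ∀ {k m N} .{{_ : NonZero N}} → k ℕ.* m ≡ N → 0 < k
k*m≡N⇒0<k {zero}  {N = N} 0≡N = ⊥-elim (ℕ.≢-nonZero⁻¹ N (sym 0≡N))
k*m≡N⇒0<k {suc _} _           = s≤s z≤n

module GapConditions {n : ℕ} .{{_ : NonZero n}} {S T : Subset n} {a b c : ℕ} .{{_ : NonZero a}} .{{_ : NonZero b}}
  (S-separated : Separated a (lift S)) (T-separated : Separated a (lift T))
  (S-T-apart : Apart b c (lift S) (lift T)) where

  module ShiftedUnion (2a≤b+c : 2 ℕ.* a ≤ b ℕ.+ c) where

    μ : ℤ
    μ = + a - + c

    private
      a+a≤1*[b+c] : a ℕ.+ a ≤ 1 ℕ.* (b ℕ.+ c)
      a+a≤1*[b+c] = subst₂ _≤_ (cong (a ℕ.+_) (ℕP.+-identityʳ a)) (sym (ℕP.*-identityˡ (b ℕ.+ c))) 2a≤b+c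

      c+μ≡a : + 1 * + c + μ ≡ + a
      c+μ≡a = cancel (+ c) (+ a)
        where
        cancel : ∀ c a → + 1 * c + (a - c) ≡ a
        cancel = solve-∀

    open TwoSets S T S-separated T-separated S-T-apart 1 μ {a} {a}
      c+μ≡a ℕP.≤-refl a+a≤1*[b+c] (ℕP.≤-reflexive (sym (ℕP.*-identityˡ a)))

    [∣S∣+∣T∣]*a≤n : (card S ℕ.+ card T) ℕ.* a ≤ n
    [∣S∣+∣T∣]*a≤n = subst ((card S ℕ.+ card T) ℕ.* a ≤_) (ℕP.*-identityˡ n) [∣S∣+∣T∣]*m≤σn

    U : Subset n
    U = S ∪ (T +ₛ ⟦ μ ⟧)

    image⇔lift-U : ∀ z → Image z ⇔ lift U z
    image⇔lift-U z = mk⇔ to from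
      where
      cancel : ∀ j μ → + 1 * j + μ - μ ≡ j
      cancel = solve-∀
      uncancel : ∀ z μ → z ≡ + 1 * (z - μ) + μ
      uncancel = solve-∀
      to : Image z → lift U z
      to (inj₁ (i , Si , refl)) = ∈⇒lift (SubsetP.x∈p∪q⁺ (inj₁
        (subst (_∈ S) (cong ⟦_⟧ (sym (ℤP.*-identityˡ i))) (lift⇒∈ Si))))
      to (inj₂ (j , Tj , refl)) = ∈⇒lift (SubsetP.x∈p∪q⁺ (inj₂ (Equivalence.from (∈+ₛ⇔ T ⟦ μ ⟧ _)
        (subst (_∈ T) (sym (trans (⟦⟧-homo-⊖ (+ 1 * j + μ) μ) (cong ⟦_⟧ (cancel j μ)))) (lift⇒∈ Tj)))))
      from : lift U z → Image z
      from Uz with SubsetP.x∈p∪q⁻ S (T +ₛ ⟦ μ ⟧) (lift⇒∈ Uz)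
      ... | inj₁ z∈S   = inj₁ (z , ∈⇒lift z∈S , sym (ℤP.*-identityˡ z))
      ... | inj₂ z∈T+μ = inj₂ (z - μ , ∈⇒lift (subst (_∈ T) (⟦⟧-homo-⊖ z μ) (Equivalence.to (∈+ₛ⇔ T ⟦ μ ⟧ _) z∈T+μ)) ,
                               uncancel z μ)

    S∩[T+μ]≡⊥ : S ∩ (T +ₛ ⟦ μ ⟧) ≡ ⊥
    S∩[T+μ]≡⊥ = SubsetP.Empty-unique λ (x , x∈S∩[T+μ]) →
      let x∈S , x∈T+μ = SubsetP.x∈p∩q⁻ S (T +ₛ ⟦ μ ⟧) x∈S∩[T+μ] in
      S-below-T {rep x} {rep x - μ} {0} (rep∈lift x∈S)
        (∈⇒lift (subst (_∈ T) (⊖-⟦⟧ x μ) (Equivalence.to (∈+ₛ⇔ T ⟦ μ ⟧ x) x∈T+μ)))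
        (shift (rep x) μ) (ℕ.>-nonZero⁻¹ a)
      where
      shift : ∀ x μ → + 1 * x + + 0 ≡ + 1 * (x - μ) + μ
      shift = solve-∀

    module Tight ([∣S∣+∣T∣]*a≡n : (card S ℕ.+ card T) ℕ.* a ≡ n) where

      image-closed : ClosedUnder+ a Image
      image-closed = [∣S∣+∣T∣]*m≡σn⇒image-closed (trans [∣S∣+∣T∣]*a≡n (sym (ℕP.*-identityˡ n)))

      S≠∅⊎T≠∅ : Nonempty S ⊎ Nonempty T
      S≠∅⊎T≠∅ = 0<∣S∣+∣T∣⇒S≠∅⊎T≠∅ S T (k*m≡N⇒0<k [∣S∣+∣T∣]*a≡n)

      U-separated : Separated a (lift U)
      U-separated = Separated-resp-⇔ image⇔lift-U image-separated

      U-closed : ClosedUnder+ a (lift U)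
      U-closed = ClosedUnder+-resp-⇔ image⇔lift-U image-closed

      U≠∅ : Nonempty U
      U≠∅ with S≠∅⊎T≠∅
      ... | inj₁ (x , x∈S) = x , SubsetP.x∈p∪q⁺ (inj₁ x∈S)
      ... | inj₂ (y , y∈T) = _ , lift⇒∈ (Equivalence.to (image⇔lift-U _) (inj₂ (rep y , rep∈lift y∈T , refl)))

      disjoint-union-coset : a ∣ n × S ∩ (T +ₛ ⟦ μ ⟧) ≡ ⊥ × IsTranslateOfMultiples a U
      disjoint-union-coset = proj₁ U-translate , S∩[T+μ]≡⊥ , proj₂ U-translate
        where
        U-translate : a ∣ n × IsTranslateOfMultiples a U
        U-translate = separated-closed⇒translate U U-separated U-closed U≠∅

      module Strict (2a<b+c : 2 ℕ.* a < b ℕ.+ c) where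

        private
          a+a<1*[b+c] : a ℕ.+ a < 1 ℕ.* (b ℕ.+ c)
          a+a<1*[b+c] = subst₂ _<_ (cong (a ℕ.+_) (ℕP.+-identityʳ a)) (sym (ℕP.*-identityˡ (b ℕ.+ c))) 2a<b+c

        T-closed : ClosedUnder+ a (lift T)
        T-closed {j} Tj = step (image-closed {+ 1 * j + μ} (inj₂ (j , Tj , refl)))
          where
          open ≡-Reasoning
          uncancel : ∀ j μ → j ≡ + 1 * j + μ - μ
          uncancel = solve-∀
          cancel : ∀ j μ a → + 1 * j + μ + a - μ ≡ j + a
          cancel = solve-∀
          step : Image (+ 1 * j + μ + + a) → lift T (j + + a)
          step (inj₁ (i , Si , eq))   = ⊥-elim (T-below-S Tj Si eq a+a<1*[b+c])
          step (inj₂ (j′ , Tj′ , eq)) = subst (lift T) (begin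
            j′                      ≡⟨ uncancel j′ μ ⟩
            + 1 * j′ + μ - μ        ≡⟨ cong (_- μ) eq ⟨
            + 1 * j + μ + + a - μ   ≡⟨ cancel j μ (+ a) ⟩
            j + + a                 ∎) Tj′

        S-closed : Empty T → ClosedUnder+ a (lift S)
        S-closed T=∅ {i} Si = step (image-closed {+ 1 * i} (inj₁ (i , Si , refl)))
          where
          open ≡-Reasoning
          step : Image (+ 1 * i + + a) → lift S (i + + a)
          step (inj₁ (i′ , Si′ , eq)) = subst (lift S) (begin
            i′              ≡⟨ ℤP.*-identityˡ i′ ⟨
            + 1 * i′        ≡⟨ eq ⟨
            + 1 * i + + a   ≡⟨ cong (_+ + a) (ℤP.*-identityˡ i) ⟩
            i + + a         ∎) Si′
          step (inj₂ (j , Tj , _))    = ⊥-elim (T=∅ (⟦ j ⟧ , lift⇒∈ Tj))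

        -- U is a single coset of aℤ and T + μ is a union of such cosets, so a point of S
        -- would also lie in T + μ.
        S≠∅⇒T=∅ : Nonempty S → Empty T
        S≠∅⇒T=∅ (s , s∈S) (t , t∈T) = S-below-T {rep s} {t′} {0} (rep∈lift s∈S) t′∈T s≡t′+μ (ℕ.>-nonZero⁻¹ a)
          where
          open ≡-Reasoning
          ⟦s⟧≡⟦t+μ+a*k⟧ : ∃ λ k → ⟦_⟧ {n} (+ 1 * rep s) ≡ ⟦ + 1 * rep t + μ + + a * k ⟧
          ⟦s⟧≡⟦t+μ+a*k⟧ = separated-closed⇒congruent {A = lift U} U-closed U-separated {n} (lift-periodic U)
            (Equivalence.to (image⇔lift-U _) (inj₂ (rep t , rep∈lift t∈T , refl)))
            (Equivalence.to (image⇔lift-U _) (inj₁ (rep s , rep∈lift s∈S , refl)))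
          k : ℤ
          k = proj₁ ⟦s⟧≡⟦t+μ+a*k⟧
          s≡t+μ+a*k+l*n : ∃ λ l → + 1 * rep s ≡ + 1 * rep t + μ + + a * k + l * + n
          s≡t+μ+a*k+l*n = ⟦i⟧≡⟦j⟧⇒i≡j+k*N (+ 1 * rep s) (+ 1 * rep t + μ + + a * k) (proj₂ ⟦s⟧≡⟦t+μ+a*k⟧)
          l : ℤ
          l = proj₁ s≡t+μ+a*k+l*n
          t′ : ℤ
          t′ = rep t + + a * k + l * + n
          t′∈T : lift T t′
          t′∈T = lift-periodic T l (closed⇒+multiple {A = lift T} T-closed (lift-periodic T) (rep∈lift t∈T) k)
          regroup : ∀ t μ x y → t + μ + x + y ≡ + 1 * (t + x + y) + μ
          regroup = solve-∀
          s≡t′+μ : + 1 * rep s + + 0 ≡ + 1 * t′ + μ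
          s≡t′+μ = begin
            + 1 * rep s + + 0                     ≡⟨ ℤP.+-identityʳ (+ 1 * rep s) ⟩
            + 1 * rep s                           ≡⟨ proj₂ s≡t+μ+a*k+l*n ⟩
            + 1 * rep t + μ + + a * k + l * + n   ≡⟨ cong (λ x → x + μ + + a * k + l * + n) (ℤP.*-identityˡ (rep t)) ⟩
            rep t + μ + + a * k + l * + n         ≡⟨ regroup (rep t) μ (+ a * k) (l * + n) ⟩
            + 1 * t′ + μ                          ∎

        one-translate-other-empty :
          a ∣ n × ((S ≡ ⊥ × IsTranslateOfMultiples a T) ⊎ (T ≡ ⊥ × IsTranslateOfMultiples a S))
        one-translate-other-empty with SubsetP.nonempty? S
        ... | yes S≠∅ = proj₁ S-translate , inj₂ (SubsetP.Empty-unique (S≠∅⇒T=∅ S≠∅) , proj₂ S-translate)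
          where
          S-translate : a ∣ n × IsTranslateOfMultiples a S
          S-translate = separated-closed⇒translate S S-separated (S-closed (S≠∅⇒T=∅ S≠∅)) S≠∅
        ... | no  S=∅ = proj₁ T-translate , inj₁ (SubsetP.Empty-unique S=∅ , proj₂ T-translate)
          where
          T≠∅ : Nonempty T
          T≠∅ with S≠∅⊎T≠∅
          ... | inj₁ S≠∅ = ⊥-elim (S=∅ S≠∅)
          ... | inj₂ T≠∅ = T≠∅
          T-translate : a ∣ n × IsTranslateOfMultiples a T
          T-translate = separated-closed⇒translate T T-separated T-closed T≠∅

  module DoubledUnion (b+c<2a : b ℕ.+ c < 2 ℕ.* a) where

    private instance
      b+c-nonZero : NonZero (b ℕ.+ c)
      b+c-nonZero = ℕ.>-nonZero (ℕP.<-≤-trans (ℕ.>-nonZero⁻¹ b) (ℕP.m≤m+n b c))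
      2n-nonZero : NonZero (2 ℕ.* n)
      2n-nonZero = ℕP.m*n≢0 2 n

    μ : ℤ
    μ = + b - + c

    private
      2c+μ≡b+c : + 2 * + c + μ ≡ + (b ℕ.+ c)
      2c+μ≡b+c = trans (cancel (+ b) (+ c)) (sym (ℤP.pos-+ b c))
        where
        cancel : ∀ b c → + 2 * c + (b - c) ≡ b + c
        cancel = solve-∀

      [b+c]+[b+c]≤2[b+c] : (b ℕ.+ c) ℕ.+ (b ℕ.+ c) ≤ 2 ℕ.* (b ℕ.+ c)
      [b+c]+[b+c]≤2[b+c] = ℕP.≤-reflexive (cong ((b ℕ.+ c) ℕ.+_) (sym (ℕP.+-identityʳ (b ℕ.+ c))))

    open TwoSets S T S-separated T-separated S-T-apart 2 μ {b ℕ.+ c} {b ℕ.+ c}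
      2c+μ≡b+c ℕP.≤-refl [b+c]+[b+c]≤2[b+c] (ℕP.<⇒≤ b+c<2a)

    [∣S∣+∣T∣]*[b+c]≤2n : (card S ℕ.+ card T) ℕ.* (b ℕ.+ c) ≤ 2 ℕ.* n
    [∣S∣+∣T∣]*[b+c]≤2n = [∣S∣+∣T∣]*m≤σn

    module Tight ([∣S∣+∣T∣]*[b+c]≡2n : (card S ℕ.+ card T) ℕ.* (b ℕ.+ c) ≡ 2 ℕ.* n) where

      image-closed : ClosedUnder+ (b ℕ.+ c) Image
      image-closed = [∣S∣+∣T∣]*m≡σn⇒image-closed [∣S∣+∣T∣]*[b+c]≡2n

      private
        b+c≢0 : b ℕ.+ c ≢ 0
        b+c≢0 = ℕ.≢-nonZero⁻¹ (b ℕ.+ c)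

      -- In the tiling, the point following 2i is 2(i + c) ∈ 2T + μ and the point following
      -- 2j + μ is 2(j + b) ∈ 2S: a successor of the same kind would be a gap b + c < 2a.
      S+c⊆T : ∀ {i} → lift S i → lift T (i + + c)
      S+c⊆T {i} Si = step (image-closed {+ 2 * i} (inj₁ (i , Si , refl)))
        where
        open ≡-Reasoning
        uncancel : ∀ x μ → x ≡ x + μ - μ
        uncancel = solve-∀
        cancel : ∀ i b c → + 2 * i + (b + c) - (b - c) ≡ + 2 * (i + c)
        cancel = solve-∀
        step : Image (+ 2 * i + + (b ℕ.+ c)) → lift T (i + + c)
        step (inj₁ (i′ , Si′ , eq)) =
          ⊥-elim (b+c≢0 (proj₂ (scale-separated 2 {a} {lift S} S-separated {i} {i′} Si Si′ eq b+c<2a)))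
        step (inj₂ (j , Tj , eq))   = subst (lift T) (ℤP.*-cancelˡ-≡ (+ 2) j (i + + c) (begin
          + 2 * j                               ≡⟨ uncancel (+ 2 * j) μ ⟩
          + 2 * j + μ - μ                       ≡⟨ cong (_- μ) eq ⟨
          + 2 * i + + (b ℕ.+ c) - μ             ≡⟨ cong (λ x → + 2 * i + x - μ) (ℤP.pos-+ b c) ⟩
          + 2 * i + (+ b + + c) - (+ b - + c)   ≡⟨ cancel i (+ b) (+ c) ⟩
          + 2 * (i + + c)                       ∎)) Tj

      T+b⊆S : ∀ {j} → lift T j → lift S (j + + b)
      T+b⊆S {j} Tj = step (image-closed {+ 2 * j + μ} (inj₂ (j , Tj , refl)))
        where
        open ≡-Reasoning
        cancel : ∀ j b c → + 2 * j + (b - c) + (b + c) ≡ + 2 * (j + b)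
        cancel = solve-∀
        step : Image (+ 2 * j + μ + + (b ℕ.+ c)) → lift S (j + + b)
        step (inj₁ (i , Si , eq))   = subst (lift S) (ℤP.*-cancelˡ-≡ (+ 2) i (j + + b) (begin
          + 2 * i                               ≡⟨ eq ⟨
          + 2 * j + μ + + (b ℕ.+ c)             ≡⟨ cong (λ x → + 2 * j + μ + x) (ℤP.pos-+ b c) ⟩
          + 2 * j + (+ b - + c) + (+ b + + c)   ≡⟨ cancel j (+ b) (+ c) ⟩
          + 2 * (j + + b)                       ∎)) Si
        step (inj₂ (j′ , Tj′ , eq)) = ⊥-elim (b+c≢0 (proj₂ (shifted-T-separated Tj Tj′ eq b+c<2a)))

      S-closed : ClosedUnder+ (b ℕ.+ c) (lift S)
      S-closed {i} Si = subst (lift S) (trans (regroup i (+ c) (+ b)) (cong (_+_ i) (sym (ℤP.pos-+ b c))))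
                          (T+b⊆S (S+c⊆T Si))
        where
        regroup : ∀ i c b → i + c + b ≡ i + (b + c)
        regroup = solve-∀

      T-closed : ClosedUnder+ (b ℕ.+ c) (lift T)
      T-closed {j} Tj = subst (lift T) (trans (ℤP.+-assoc j (+ b) (+ c)) (cong (_+_ j) (sym (ℤP.pos-+ b c))))
                          (S+c⊆T (T+b⊆S Tj))

      S-separated-by-b+c : Separated (b ℕ.+ c) (lift S)
      S-separated-by-b+c {i} {zero}  _  _    _     = refl
      S-separated-by-b+c {i} {suc d} Si Si+d d<b+c =
        ⊥-elim (S-T-apart Si+d (S+c⊆T Si) (cancel i (+ suc d) (+ c)) (s≤s z≤n) d<b+c)
        where
        cancel : ∀ i d c → i + d - (i + c) + c ≡ d
        cancel = solve-∀

      T-separated-by-b+c : Separated (b ℕ.+ c) (lift T)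
      T-separated-by-b+c {j} {zero}  _  _    _     = refl
      T-separated-by-b+c {j} {suc d} Tj Tj+d d<b+c with ℕP.m≤n⇒∃[o]m+o≡n (ℕP.<⇒≤ d<b+c)
      ... | e , d+e≡b+c = ⊥-elim (S-T-apart (T+b⊆S Tj) Tj+d j+b-[j+d]+c≡e (ℕP.n≢0⇒n>0 e≢0)
                                   (subst (e <_) d+e≡b+c (ℕP.m<n+m e (s≤s z≤n))))
        where
        open ≡-Reasoning
        e≢0 : e ≢ 0
        e≢0 e≡0 = ℕP.<-irrefl (trans (sym (ℕP.+-identityʳ (suc d))) (trans (cong (suc d ℕ.+_) (sym e≡0)) d+e≡b+c)) d<b+c
        regroup : ∀ j b c d → j + b - (j + d) + c ≡ (b + c) - d
        regroup = solve-∀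
        cancel : ∀ d e → d + e - d ≡ e
        cancel = solve-∀
        j+b-[j+d]+c≡e : j + + b - (j + + suc d) + + c ≡ + e
        j+b-[j+d]+c≡e = begin
          j + + b - (j + + suc d) + + c   ≡⟨ regroup j (+ b) (+ c) (+ suc d) ⟩
          (+ b + + c) - + suc d           ≡⟨ cong (_- + suc d) (ℤP.pos-+ b c) ⟨
          + (b ℕ.+ c) - + suc d           ≡⟨ cong (λ x → + x - + suc d) d+e≡b+c ⟨
          + (suc d ℕ.+ e) - + suc d       ≡⟨ cong (_- + suc d) (ℤP.pos-+ (suc d) e) ⟩
          + suc d + + e - + suc d         ≡⟨ cancel (+ suc d) (+ e) ⟩
          + e                             ∎

      S≠∅×T≠∅ : Nonempty S × Nonempty T
      S≠∅×T≠∅ with 0<∣S∣+∣T∣⇒S≠∅⊎T≠∅ S T (k*m≡N⇒0<k [∣S∣+∣T∣]*[b+c]≡2n)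
      ... | inj₁ (x , x∈S) = (x , x∈S) , (⟦ rep x + + c ⟧ , lift⇒∈ (S+c⊆T (rep∈lift x∈S)))
      ... | inj₂ (y , y∈T) = (⟦ rep y + + b ⟧ , lift⇒∈ (T+b⊆S (rep∈lift y∈T))) , (y , y∈T)

      S≡T-c : S ≡ T +ₛ ⟦ - (+ c) ⟧
      S≡T-c = SubsetP.⊆-antisym S⊆T-c T-c⊆S
        where
        minus-neg : ∀ x c → x - (- c) ≡ x + c
        minus-neg = solve-∀
        cancel : ∀ x b c → x + c + b + (b + c) * - (+ 1) ≡ x
        cancel = solve-∀
        x⊖⟦-c⟧≡⟦x+c⟧ : ∀ (x : Fin n) → x ⊖ ⟦ - (+ c) ⟧ ≡ ⟦ rep x + + c ⟧
        x⊖⟦-c⟧≡⟦x+c⟧ x = trans (⊖-⟦⟧ x (- (+ c))) (cong ⟦_⟧ (minus-neg (rep x) (+ c)))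
        S⊆T-c : ∀ {x} → x ∈ S → x ∈ T +ₛ ⟦ - (+ c) ⟧
        S⊆T-c {x} x∈S = Equivalence.from (∈+ₛ⇔ T ⟦ - (+ c) ⟧ x)
          (subst (_∈ T) (sym (x⊖⟦-c⟧≡⟦x+c⟧ x)) (lift⇒∈ (S+c⊆T (rep∈lift x∈S))))
        T-c⊆S : ∀ {x} → x ∈ T +ₛ ⟦ - (+ c) ⟧ → x ∈ S
        T-c⊆S {x} x∈T-c = subst (_∈ S) (⟦⟧-rep x) (lift⇒∈ (subst (lift S) x+c+b-[b+c]≡x
          (closed⇒+multiple {A = lift S} S-closed (lift-periodic S) (T+b⊆S x+c∈T) (- (+ 1)))))
          where
          x+c∈T : lift T (rep x + + c)
          x+c∈T = ∈⇒lift (subst (_∈ T) (x⊖⟦-c⟧≡⟦x+c⟧ x) (Equivalence.to (∈+ₛ⇔ T ⟦ - (+ c) ⟧ x) x∈T-c))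
          x+c+b-[b+c]≡x : rep x + + c + + b + + (b ℕ.+ c) * - (+ 1) ≡ rep x
          x+c+b-[b+c]≡x = trans (cong (λ m → rep x + + c + + b + m * - (+ 1)) (ℤP.pos-+ b c))
                                (cancel (rep x) (+ b) (+ c))

      cosets : (b ℕ.+ c) ∣ n × S ≡ T +ₛ ⟦ - (+ c) ⟧ ×
               IsTranslateOfMultiples (b ℕ.+ c) S × IsTranslateOfMultiples (b ℕ.+ c) T
      cosets = proj₁ S-translate , S≡T-c , proj₂ S-translate , proj₂ T-translate
        where
        S-translate : (b ℕ.+ c) ∣ n × IsTranslateOfMultiples (b ℕ.+ c) S
        S-translate = separated-closed⇒translate S S-separated-by-b+c S-closed (proj₁ S≠∅×T≠∅)
        T-translate : (b ℕ.+ c) ∣ n × IsTranslateOfMultiples (b ℕ.+ c) T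
        T-translate = separated-closed⇒translate T T-separated-by-b+c T-closed (proj₂ S≠∅×T≠∅)

lemma3p8 : (n : ℕ) .{{_ : NonZero n}} (S T : Subset n)
  (a b c : ℕ) .{{_ : NonZero a}} .{{_ : NonZero b}} .{{_ : NonZero c}} →
  (∀ x y → x ∈ S → y ∈ S → (d : ℕ) → 1 ≤ d → d < a → x ⊖ y ≢ ⟦ + d ⟧) →
  (∀ x y → x ∈ T → y ∈ T → (d : ℕ) → 1 ≤ d → d < a → x ⊖ y ≢ ⟦ + d ⟧) →
  (∀ x y → x ∈ S → y ∈ T → (d : ℤ) → - (+ c) ℤ.< d → d ℤ.< + b → x ⊖ y ≢ ⟦ d ⟧) →
  ((+ (card S ℕ.+ card T)) ℚ./ 1 ℚ.≤ bound n a b c)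
  × (2 ℕ.* a < b ℕ.+ c → (+ (card S ℕ.+ card T)) ℚ./ 1 ≡ bound n a b c →
      a ∣ n
      × ((S ≡ ⊥ × IsTranslateOfMultiples a T) ⊎ (T ≡ ⊥ × IsTranslateOfMultiples a S)))
  × (2 ℕ.* a > b ℕ.+ c → (+ (card S ℕ.+ card T)) ℚ./ 1 ≡ bound n a b c →
      (b ℕ.+ c) ∣ n
      × S ≡ T +ₛ ⟦ - (+ c) ⟧
      × IsTranslateOfMultiples (b ℕ.+ c) S
      × IsTranslateOfMultiples (b ℕ.+ c) T)
  × (2 ℕ.* a ≡ b ℕ.+ c → (+ (card S ℕ.+ card T)) ℚ./ 1 ≡ bound n a b c →
      a ∣ n
      × S ∩ (T +ₛ ⟦ + a ℤ.- + c ⟧) ≡ ⊥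
      × IsTranslateOfMultiples a (S ∪ (T +ₛ ⟦ + a ℤ.- + c ⟧)))
lemma3p8 n S T a b c S-gaps T-gaps S-T-gaps =
    ∣S∣+∣T∣≤bound
  , (λ 2a<b+c tight → ShiftedUnion.Tight.Strict.one-translate-other-empty (ℕP.<⇒≤ 2a<b+c)
                        (k≡bound⇒k*a≡n n a b c ∣S∣+∣T∣ (ℕP.<⇒≤ 2a<b+c) tight) 2a<b+c)
  , (λ b+c<2a tight → DoubledUnion.Tight.cosets b+c<2a (k≡bound⇒k*[b+c]≡2n n a b c ∣S∣+∣T∣ b+c<2a tight))
  , (λ 2a≡b+c tight → ShiftedUnion.Tight.disjoint-union-coset (ℕP.≤-reflexive 2a≡b+c)
                        (k≡bound⇒k*a≡n n a b c ∣S∣+∣T∣ (ℕP.≤-reflexive 2a≡b+c) tight))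
  where
  open GapConditions (lift-separated S-gaps) (lift-separated T-gaps) (lift-apart S-T-gaps)

  ∣S∣+∣T∣ : ℕ
  ∣S∣+∣T∣ = card S ℕ.+ card T

  ∣S∣+∣T∣≤bound : + ∣S∣+∣T∣ ℚ./ 1 ℚ.≤ bound n a b c
  ∣S∣+∣T∣≤bound with 2 ℕ.* a ℕ.≤? b ℕ.+ c
  ... | yes 2a≤b+c = k*a≤n⇒k≤bound n a b c ∣S∣+∣T∣ (ShiftedUnion.[∣S∣+∣T∣]*a≤n 2a≤b+c)
  ... | no  2a≰b+c = k*[b+c]≤2n⇒k≤bound n a b c ∣S∣+∣T∣ (DoubledUnion.[∣S∣+∣T∣]*[b+c]≤2n (ℕP.≰⇒> 2a≰b+c))
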